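{- For every integer $n\ge0$, $$\sum_{k=0}^{n}\frac{1}{2^{4k}}\binom{2k}{k}^2\frac{1}{2n-2k+1}=\sum_{k=0}^{n}\frac{1}{2^{4k}}\binom{2k}{k}^2\frac{1}{n+k+1}=\frac{2^{4n}}{(2n+1)^2\binom{2n}{n}^2}\sum_{k=0}^{n}\frac{4k+1}{2^{8k}}\binom{2k}{k}^4.$$ -}

module Defs where

open import Data.Nat as ℕ using (ℕ; zero; suc; _∸_; NonZero; _≤_; z≤n; s≤s)
open import Data.Nat.Properties as ℕₚ using (m^n≢0; ≤-trans; m≤m+n; ≤-refl)
open import Data.Integer using (+_)
open import Data.Rational using (ℚ; _/_; _+_; _*_)
open import Data.Nat.Combinatorics using (_C_; nCn≡1; nCk+nC[k+1]≡[n+1]C[k+1])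
open import Relation.Binary.PropositionalEquality using (sym; subst)

C-pos : ∀ n k → k ≤ n → 1 ≤ n C k
C-pos zero    zero    _ = s≤s z≤n
C-pos (suc n) zero    _ = s≤s z≤n
C-pos (suc n) (suc k) (s≤s k≤n) =
  subst (1 ≤_) (nCk+nC[k+1]≡[n+1]C[k+1] n k)
        (≤-trans (C-pos n k k≤n) (m≤m+n (n C k) (n C suc k)))

central-nonZero : ∀ n → NonZero ((2 ℕ.* n) C n)
central-nonZero n = ℕ.>-nonZero (C-pos (2 ℕ.* n) n (m≤m+n n (n ℕ.+ 0)))

infix 5 _/ₙ_
_/ₙ_ : ℕ → (d : ℕ) → .{{NonZero d}} → ℚ
a /ₙ d = (+ a) / d

Σ-to : ℕ → (ℕ → ℚ) → ℚ
Σ-to zero    f = f 0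
Σ-to (suc n) f = Σ-to n f + f (suc n)

-- Write a k = C(2k,k)² / 16ᵏ and c n = (2n+1)² a n; the recurrence of the central binomial
-- coefficients gives c k = (2k+2)² a (k+1).  Each of the two sums S n satisfies
-- c n · S n = T n := Σ_{k≤n} (4k+1) a k², by induction on n.  Passing from n to n+1, the
-- rescaled summands differ by a telescoping term, e.g.
--   c (n+1) a k/(n+k+2) + h k = c n a k/(n+k+1) + h (k+1),   h k = a (n+1) (2k)² a k/(n+k+1),
-- and the boundary term h (n+1) together with the new summand is exactly (4n+5) a (n+1)².
-- The weights 1/(2n-2k+1) behave the same way with h k = a (n+1) (2k)² a k/(2n-2k+3).
module Submission where

open import Defs
open import Data.Nat as ℕ using (ℕ; zero; suc; NonZero; _≤_; z≤n; _∸_; _!)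
open import Data.Nat.Properties as ℕ using (m^n≢0; m*n≢0; _!*_!≢0)
open import Data.Nat.DivMod using (m/n*n≡m)
open import Data.Nat.Combinatorics using (_C_; k![n∸k]!∣n!)
open import Data.Nat.Combinatorics.Specification using (nCk≡n!/k![n-k]!)
import Data.Nat.Tactic.RingSolver as ℕ-Solver
open import Data.Nat.Solver using (module +-*-Solver)
open +-*-Solver using (solve; _:=_; con; _:+_; _:*_; _:^_)
import Data.Integer as ℤ
import Data.Integer.Properties as ℤ
import Data.Integer.Tactic.RingSolver as ℤ-Solver
open import Data.Rational using (ℚ; _+_; _*_; 0ℚ; 1ℚ; toℚᵘ)
open import Data.Rational.Properties
  using ( toℚᵘ-injective; toℚᵘ-fromℚᵘ; toℚᵘ-homo-+; toℚᵘ-homo-*; +-*-commutativeRing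
        ; +-0-commutativeMonoid; +-assoc; +-identityʳ; *-distribˡ-+; *-zeroˡ; *-zeroʳ
        ; *-identityˡ; *-identityʳ; *-assoc)
open import Data.Rational.Unnormalised as ℚᵘ using (mkℚᵘ; _≃_; *≡*)
import Data.Rational.Unnormalised.Properties as ℚᵘ
open import Algebra.Bundles using (CommutativeMonoid)
open import Algebra.Properties.CommutativeSemigroup
  (CommutativeMonoid.commutativeSemigroup +-0-commutativeMonoid)
  using (xy∙z≈xz∙y; xy∙z≈x∙zy; x∙yz≈xz∙y)
open import Data.Maybe using (nothing)
import Tactic.RingSolver.Core.AlmostCommutativeRing as ACR
open import Tactic.RingSolver using (solve-∀)
open import Data.Product using (_×_; _,_)
open import Relation.Binary.PropositionalEquality
open ≡-Reasoning

ℚ-ring : ACR.AlmostCommutativeRing _ _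
ℚ-ring = ACR.fromCommutativeRing +-*-commutativeRing (λ _ → nothing)

*-distribˡ-Σ-to : ∀ n x (f : ℕ → ℚ) → Σ-to n (λ k → x * f k) ≡ x * Σ-to n f
*-distribˡ-Σ-to zero    x f = refl
*-distribˡ-Σ-to (suc n) x f = begin
  Σ-to n (λ k → x * f k) + x * f (suc n) ≡⟨ cong (_+ x * f (suc n)) (*-distribˡ-Σ-to n x f) ⟩
  x * Σ-to n f + x * f (suc n)           ≡⟨ *-distribˡ-+ x (Σ-to n f) (f (suc n)) ⟨
  x * (Σ-to n f + f (suc n))             ∎

Σ-to-telescope : ∀ n (f g h : ℕ → ℚ) → (∀ k → k ≤ n → f k + h k ≡ g k + h (suc k)) →
                 Σ-to n f + h 0 ≡ Σ-to n g + h (suc n)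
Σ-to-telescope zero    f g h step = step 0 z≤n
Σ-to-telescope (suc n) f g h step = begin
  Σ-to n f + f (suc n) + h 0               ≡⟨ xy∙z≈xz∙y (Σ-to n f) (f (suc n)) (h 0) ⟩
  Σ-to n f + h 0 + f (suc n)               ≡⟨ cong (_+ f (suc n)) (Σ-to-telescope n f g h step′) ⟩
  Σ-to n g + h (suc n) + f (suc n)         ≡⟨ xy∙z≈x∙zy (Σ-to n g) (h (suc n)) (f (suc n)) ⟩
  Σ-to n g + (f (suc n) + h (suc n))       ≡⟨ cong (Σ-to n g +_) (step (suc n) ℕ.≤-refl) ⟩
  Σ-to n g + (g (suc n) + h (suc (suc n))) ≡⟨ +-assoc (Σ-to n g) (g (suc n)) (h (suc (suc n))) ⟨
  Σ-to n g + g (suc n) + h (suc (suc n))   ∎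
  where
  step′ : ∀ k → k ≤ n → f k + h k ≡ g k + h (suc k)
  step′ k k≤n = step k (ℕ.m≤n⇒m≤1+n k≤n)

scaled-Σ-to-telescope : ∀ n (x y : ℚ) (s t h : ℕ → ℚ) → h 0 ≡ 0ℚ →
                        (∀ k → k ≤ n → x * s k + h k ≡ y * t k + h (suc k)) →
                        x * Σ-to n s ≡ y * Σ-to n t + h (suc n)
scaled-Σ-to-telescope n x y s t h h0≡0 step = begin
  x * Σ-to n s                       ≡⟨ *-distribˡ-Σ-to n x s ⟨
  Σ-to n (λ k → x * s k)             ≡⟨ +-identityʳ (Σ-to n (λ k → x * s k)) ⟨
  Σ-to n (λ k → x * s k) + 0ℚ        ≡⟨ cong (Σ-to n (λ k → x * s k) +_) h0≡0 ⟨
  Σ-to n (λ k → x * s k) + h 0       ≡⟨ Σ-to-telescope n (λ k → x * s k) (λ k → y * t k) h step ⟩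
  Σ-to n (λ k → y * t k) + h (suc n) ≡⟨ cong (_+ h (suc n)) (*-distribˡ-Σ-to n y t) ⟩
  y * Σ-to n t + h (suc n)           ∎

fromℕ : ℕ → ℚ
fromℕ m = m /ₙ 1

toℚᵘ-/ₙ : ∀ m d → toℚᵘ (m /ₙ suc d) ≃ mkℚᵘ (ℤ.+ m) d
toℚᵘ-/ₙ m d = toℚᵘ-fromℚᵘ (mkℚᵘ (ℤ.+ m) d)

/ₙ-cross : ∀ m n d e .{{_ : NonZero d}} .{{_ : NonZero e}} → m ℕ.* e ≡ n ℕ.* d → m /ₙ d ≡ n /ₙ e
/ₙ-cross m n (suc d) (suc e) me≡nd = toℚᵘ-injective (ℚᵘ.≃-trans (toℚᵘ-/ₙ m d)
  (ℚᵘ.≃-trans (*≡* (trans (sym (ℤ.pos-* m (suc e))) (trans (cong ℤ.+_ me≡nd) (ℤ.pos-* n (suc d)))))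
              (ℚᵘ.≃-sym (toℚᵘ-/ₙ n e))))

/ₙ-* : ∀ m n d e .{{_ : NonZero d}} .{{_ : NonZero e}} →
       (m /ₙ d) * (n /ₙ e) ≡ _/ₙ_ (m ℕ.* n) (d ℕ.* e) {{m*n≢0 d e}}
/ₙ-* m n (suc d) (suc e) = toℚᵘ-injective (ℚᵘ.≃-trans (toℚᵘ-homo-* (m /ₙ suc d) (n /ₙ suc e))
  (ℚᵘ.≃-trans (ℚᵘ.*-cong (toℚᵘ-/ₙ m d) (toℚᵘ-/ₙ n e))
  (ℚᵘ.≃-trans (ℚᵘ.≃-reflexive (cong (λ z → mkℚᵘ z _) (sym (ℤ.pos-* m n))))
              (ℚᵘ.≃-sym (toℚᵘ-/ₙ (m ℕ.* n) _)))))

fromℕ-+ : ∀ m n → fromℕ (m ℕ.+ n) ≡ fromℕ m + fromℕ n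
fromℕ-+ m n = toℚᵘ-injective (ℚᵘ.≃-trans (toℚᵘ-/ₙ (m ℕ.+ n) 0)
  (ℚᵘ.≃-trans (*≡* (trans (cong (ℤ._* ℤ.+ 1) (ℤ.pos-+ m n)) (unit-denominators (ℤ.+ m) (ℤ.+ n))))
              (ℚᵘ.≃-sym (ℚᵘ.≃-trans (toℚᵘ-homo-+ (fromℕ m) (fromℕ n))
                                    (ℚᵘ.+-cong (toℚᵘ-/ₙ m 0) (toℚᵘ-/ₙ n 0))))))
  where
  unit-denominators : ∀ x y → (x ℤ.+ y) ℤ.* ℤ.+ 1 ≡ (x ℤ.* ℤ.+ 1 ℤ.+ y ℤ.* ℤ.+ 1) ℤ.* ℤ.+ 1
  unit-denominators = ℤ-Solver.solve-∀

fromℕ-*-/ₙ : ∀ m n d .{{_ : NonZero d}} → fromℕ m * (n /ₙ d) ≡ (m ℕ.* n) /ₙ d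
fromℕ-*-/ₙ m n d = trans (/ₙ-* m n 1 d)
  (/ₙ-cross (m ℕ.* n) (m ℕ.* n) (1 ℕ.* d) d {{m*n≢0 1 d}} (cong (m ℕ.* n ℕ.*_) (sym (ℕ.*-identityˡ d))))

x≡p*d⇒x/d≡p : ∀ {x} p d .{{_ : NonZero d}} → x ≡ p ℕ.* d → (1 /ₙ d) * fromℕ x ≡ fromℕ p
x≡p*d⇒x/d≡p p d refl = trans (/ₙ-* 1 (p ℕ.* d) d 1)
  (/ₙ-cross (1 ℕ.* (p ℕ.* d)) p (d ℕ.* 1) 1 {{m*n≢0 d 1}} (cross p d))
  where
  cross : ∀ p d → 1 ℕ.* (p ℕ.* d) ℕ.* 1 ≡ p ℕ.* (d ℕ.* 1)
  cross = ℕ-Solver.solve-∀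

x≡z+p*d⇒x/d≡z/d+p : ∀ {x} z p d .{{_ : NonZero d}} → x ≡ z ℕ.+ p ℕ.* d →
                    (1 /ₙ d) * fromℕ x ≡ (1 /ₙ d) * fromℕ z + fromℕ p
x≡z+p*d⇒x/d≡z/d+p z p d refl = begin
  (1 /ₙ d) * fromℕ (z ℕ.+ p ℕ.* d)                ≡⟨ cong ((1 /ₙ d) *_) (fromℕ-+ z (p ℕ.* d)) ⟩
  (1 /ₙ d) * (fromℕ z + fromℕ (p ℕ.* d))          ≡⟨ *-distribˡ-+ (1 /ₙ d) (fromℕ z) (fromℕ (p ℕ.* d)) ⟩
  (1 /ₙ d) * fromℕ z + (1 /ₙ d) * fromℕ (p ℕ.* d) ≡⟨ cong ((1 /ₙ d) * fromℕ z +_) (x≡p*d⇒x/d≡p p d refl) ⟩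
  (1 /ₙ d) * fromℕ z + fromℕ p                    ∎

-- Both sides equal e x (v Z + u W + P).
telescoping-step : ∀ (e x u v X Y Z W P : ℚ) → v * X ≡ v * Z + P → u * Y ≡ u * W + P →
                   X * e * (x * v) + e * (W * x) * u ≡ Y * e * (x * u) + e * (Z * x) * v
telescoping-step e x u v X Y Z W P vX≡vZ+P uY≡uW+P = begin
  X * e * (x * v) + e * (W * x) * u ≡⟨ factor₁ e x u v X W ⟩
  e * x * (v * X + u * W)           ≡⟨ cong (λ t → e * x * (t + u * W)) vX≡vZ+P ⟩
  e * x * (v * Z + P + u * W)       ≡⟨ cong (e * x *_) (swap (v * Z) P (u * W)) ⟩
  e * x * (u * W + P + v * Z)       ≡⟨ cong (λ t → e * x * (t + v * Z)) uY≡uW+P ⟨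
  e * x * (u * Y + v * Z)           ≡⟨ factor₂ e x u v Y Z ⟩
  Y * e * (x * u) + e * (Z * x) * v ∎
  where
  factor₁ : ∀ e x u v X W → X * e * (x * v) + e * (W * x) * u ≡ e * x * (v * X + u * W)
  factor₁ = solve-∀ ℚ-ring
  swap : ∀ p q r → p + q + r ≡ r + q + p
  swap = solve-∀ ℚ-ring
  factor₂ : ∀ e x u v Y Z → e * x * (u * Y + v * Z) ≡ Y * e * (x * u) + e * (Z * x) * v
  factor₂ = solve-∀ ℚ-ring

nCk*[k!*[n∸k]!]≡n! : ∀ {n k} → k ≤ n → (n C k) ℕ.* (k ! ℕ.* (n ∸ k) !) ≡ n !
nCk*[k!*[n∸k]!]≡n! {n} {k} k≤n = trans (cong (ℕ._* (k ! ℕ.* (n ∸ k) !)) (nCk≡n!/k![n-k]! k≤n))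
                                       (m/n*n≡m {{k !* (n ∸ k) !≢0}} (k![n∸k]!∣n! k≤n))

[2k]Ck*[k!*k!]≡[2k]! : ∀ k → ((2 ℕ.* k) C k) ℕ.* (k ! ℕ.* k !) ≡ (2 ℕ.* k) !
[2k]Ck*[k!*k!]≡[2k]! k = subst (λ m → ((2 ℕ.* k) C k) ℕ.* (k ! ℕ.* m !) ≡ (2 ℕ.* k) !) 2k∸k≡k
                                 (nCk*[k!*[n∸k]!]≡n! (ℕ.m≤m+n k (k ℕ.+ 0)))
  where
  2k∸k≡k : 2 ℕ.* k ∸ k ≡ k
  2k∸k≡k = trans (ℕ.m+n∸m≡n k (k ℕ.+ 0)) (ℕ.+-identityʳ k)

[k+1]*[2k+2]C[k+1]≡2[2k+1]*[2k]Ck : ∀ k →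
  suc k ℕ.* ((2 ℕ.* suc k) C suc k) ≡ 2 ℕ.* suc (2 ℕ.* k) ℕ.* ((2 ℕ.* k) C k)
[k+1]*[2k+2]C[k+1]≡2[2k+1]*[2k]Ck k =
  ℕ.*-cancelʳ-≡ _ _ (suc k ℕ.* (k ! ℕ.* k !)) {{m*n≢0 (suc k) (k ! ℕ.* k !) {{_}} {{k !* k !≢0}}}} (begin
    suc k ℕ.* B′ ℕ.* (suc k ℕ.* (k ! ℕ.* k !))
      ≡⟨ regroup₁ k B′ (k !) ⟩
    B′ ℕ.* (suc k ! ℕ.* suc k !)
      ≡⟨ [2k]Ck*[k!*k!]≡[2k]! (suc k) ⟩
    (2 ℕ.* suc k) !
      ≡⟨ cong _! (2[k+1]≡2k+2 k) ⟩
    suc (suc (2 ℕ.* k)) ℕ.* (suc (2 ℕ.* k) ℕ.* (2 ℕ.* k) !)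
      ≡⟨ cong (λ m → suc (suc (2 ℕ.* k)) ℕ.* (suc (2 ℕ.* k) ℕ.* m)) ([2k]Ck*[k!*k!]≡[2k]! k) ⟨
    suc (suc (2 ℕ.* k)) ℕ.* (suc (2 ℕ.* k) ℕ.* (B ℕ.* (k ! ℕ.* k !)))
      ≡⟨ regroup₂ k B (k !) ⟩
    2 ℕ.* suc (2 ℕ.* k) ℕ.* B ℕ.* (suc k ℕ.* (k ! ℕ.* k !)) ∎)
  where
  B = (2 ℕ.* k) C k
  B′ = (2 ℕ.* suc k) C suc k
  2[k+1]≡2k+2 : ∀ k → 2 ℕ.* suc k ≡ suc (suc (2 ℕ.* k))
  2[k+1]≡2k+2 = ℕ-Solver.solve-∀
  regroup₁ : ∀ k x f → suc k ℕ.* x ℕ.* (suc k ℕ.* (f ℕ.* f)) ≡ x ℕ.* (suc k ℕ.* f ℕ.* (suc k ℕ.* f))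
  regroup₁ = ℕ-Solver.solve-∀
  regroup₂ : ∀ k x f → suc (suc (2 ℕ.* k)) ℕ.* (suc (2 ℕ.* k) ℕ.* (x ℕ.* (f ℕ.* f)))
                       ≡ 2 ℕ.* suc (2 ℕ.* k) ℕ.* x ℕ.* (suc k ℕ.* (f ℕ.* f))
  regroup₂ = ℕ-Solver.solve-∀

a : ℕ → ℚ
a k = _/ₙ_ (((2 ℕ.* k) C k) ℕ.^ 2) (2 ℕ.^ (4 ℕ.* k)) {{m^n≢0 2 (4 ℕ.* k)}}

b : ℕ → ℚ
b k = _/ₙ_ (suc (4 ℕ.* k) ℕ.* ((2 ℕ.* k) C k) ℕ.^ 4) (2 ℕ.^ (8 ℕ.* k)) {{m^n≢0 2 (8 ℕ.* k)}}

c : ℕ → ℚ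
c n = fromℕ (suc (2 ℕ.* n) ℕ.^ 2) * a n

c⁻¹ : ℕ → ℚ
c⁻¹ n = _/ₙ_ (2 ℕ.^ (4 ℕ.* n)) ((suc (2 ℕ.* n) ℕ.^ 2) ℕ.* (((2 ℕ.* n) C n) ℕ.^ 2))
          {{m*n≢0 (suc (2 ℕ.* n) ℕ.^ 2) (((2 ℕ.* n) C n) ℕ.^ 2) {{m^n≢0 (suc (2 ℕ.* n)) 2}}
                  {{m^n≢0 ((2 ℕ.* n) C n) 2 {{central-nonZero n}}}}}}

w : ℕ → ℚ
w k = fromℕ ((2 ℕ.* k) ℕ.^ 2) * a k

c≡w[k+1] : ∀ k → c k ≡ w (suc k)
c≡w[k+1] k = begin
  c k
    ≡⟨ fromℕ-*-/ₙ (suc (2 ℕ.* k) ℕ.^ 2) (B ℕ.^ 2) P ⟩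
  (suc (2 ℕ.* k) ℕ.^ 2 ℕ.* B ℕ.^ 2) /ₙ P
    ≡⟨ /ₙ-cross (suc (2 ℕ.* k) ℕ.^ 2 ℕ.* B ℕ.^ 2) ((2 ℕ.* suc k) ℕ.^ 2 ℕ.* B′ ℕ.^ 2) P P′ cross ⟩
  ((2 ℕ.* suc k) ℕ.^ 2 ℕ.* B′ ℕ.^ 2) /ₙ P′
    ≡⟨ fromℕ-*-/ₙ ((2 ℕ.* suc k) ℕ.^ 2) (B′ ℕ.^ 2) P′ ⟨
  w (suc k) ∎
  where
  B = (2 ℕ.* k) C k
  B′ = (2 ℕ.* suc k) C suc k
  P = 2 ℕ.^ (4 ℕ.* k)
  P′ = 2 ℕ.^ (4 ℕ.* suc k)
  instance
    _ = m^n≢0 2 (4 ℕ.* k)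
    _ = m^n≢0 2 (4 ℕ.* suc k)
  P′≡16P : P′ ≡ 16 ℕ.* P
  P′≡16P = trans (cong (2 ℕ.^_) (4[k+1]≡4+4k k)) (ℕ.^-distribˡ-+-* 2 4 (4 ℕ.* k))
    where
    4[k+1]≡4+4k : ∀ k → 4 ℕ.* suc k ≡ 4 ℕ.+ 4 ℕ.* k
    4[k+1]≡4+4k = ℕ-Solver.solve-∀
  regroup₁ : ∀ k x y →
    suc (2 ℕ.* k) ℕ.^ 2 ℕ.* x ℕ.^ 2 ℕ.* (16 ℕ.* y) ≡ 4 ℕ.* (2 ℕ.* suc (2 ℕ.* k) ℕ.* x) ℕ.^ 2 ℕ.* y
  regroup₁ = solve 3 (λ k x y → (con 1 :+ con 2 :* k) :^ 2 :* x :^ 2 :* (con 16 :* y)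
                            := con 4 :* (con 2 :* (con 1 :+ con 2 :* k) :* x) :^ 2 :* y) refl
  regroup₂ : ∀ k x y → 4 ℕ.* (suc k ℕ.* x) ℕ.^ 2 ℕ.* y ≡ (2 ℕ.* suc k) ℕ.^ 2 ℕ.* x ℕ.^ 2 ℕ.* y
  regroup₂ = solve 3 (λ k x y → con 4 :* ((con 1 :+ k) :* x) :^ 2 :* y
                            := (con 2 :* (con 1 :+ k)) :^ 2 :* x :^ 2 :* y) refl
  cross : suc (2 ℕ.* k) ℕ.^ 2 ℕ.* B ℕ.^ 2 ℕ.* P′ ≡ (2 ℕ.* suc k) ℕ.^ 2 ℕ.* B′ ℕ.^ 2 ℕ.* P
  cross = begin
    suc (2 ℕ.* k) ℕ.^ 2 ℕ.* B ℕ.^ 2 ℕ.* P′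
      ≡⟨ cong (suc (2 ℕ.* k) ℕ.^ 2 ℕ.* B ℕ.^ 2 ℕ.*_) P′≡16P ⟩
    suc (2 ℕ.* k) ℕ.^ 2 ℕ.* B ℕ.^ 2 ℕ.* (16 ℕ.* P)
      ≡⟨ regroup₁ k B P ⟩
    4 ℕ.* (2 ℕ.* suc (2 ℕ.* k) ℕ.* B) ℕ.^ 2 ℕ.* P
      ≡⟨ cong (λ m → 4 ℕ.* m ℕ.^ 2 ℕ.* P) ([k+1]*[2k+2]C[k+1]≡2[2k+1]*[2k]Ck k) ⟨
    4 ℕ.* (suc k ℕ.* B′) ℕ.^ 2 ℕ.* P
      ≡⟨ regroup₂ k B′ P ⟩
    (2 ℕ.* suc k) ℕ.^ 2 ℕ.* B′ ℕ.^ 2 ℕ.* P ∎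

b≡[4k+1]*a² : ∀ k → b k ≡ fromℕ (suc (4 ℕ.* k)) * (a k * a k)
b≡[4k+1]*a² k = begin
  b k
    ≡⟨ /ₙ-cross (suc (4 ℕ.* k) ℕ.* B ℕ.^ 4) (suc (4 ℕ.* k) ℕ.* (B ℕ.^ 2 ℕ.* B ℕ.^ 2))
                (2 ℕ.^ (8 ℕ.* k)) (P ℕ.* P) cross ⟩
  (suc (4 ℕ.* k) ℕ.* (B ℕ.^ 2 ℕ.* B ℕ.^ 2)) /ₙ (P ℕ.* P)
    ≡⟨ fromℕ-*-/ₙ (suc (4 ℕ.* k)) (B ℕ.^ 2 ℕ.* B ℕ.^ 2) (P ℕ.* P) ⟨
  fromℕ (suc (4 ℕ.* k)) * ((B ℕ.^ 2 ℕ.* B ℕ.^ 2) /ₙ (P ℕ.* P))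
    ≡⟨ cong (fromℕ (suc (4 ℕ.* k)) *_) (/ₙ-* (B ℕ.^ 2) (B ℕ.^ 2) P P) ⟨
  fromℕ (suc (4 ℕ.* k)) * (a k * a k) ∎
  where
  B = (2 ℕ.* k) C k
  P = 2 ℕ.^ (4 ℕ.* k)
  instance
    _ = m^n≢0 2 (4 ℕ.* k)
    _ = m^n≢0 2 (8 ℕ.* k)
    _ = m*n≢0 P P
  2^[8k]≡P*P : 2 ℕ.^ (8 ℕ.* k) ≡ P ℕ.* P
  2^[8k]≡P*P = trans (cong (2 ℕ.^_) (8k≡4k+4k k)) (ℕ.^-distribˡ-+-* 2 (4 ℕ.* k) (4 ℕ.* k))
    where
    8k≡4k+4k : ∀ k → 8 ℕ.* k ≡ 4 ℕ.* k ℕ.+ 4 ℕ.* k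
    8k≡4k+4k = ℕ-Solver.solve-∀
  cross : suc (4 ℕ.* k) ℕ.* B ℕ.^ 4 ℕ.* (P ℕ.* P)
          ≡ suc (4 ℕ.* k) ℕ.* (B ℕ.^ 2 ℕ.* B ℕ.^ 2) ℕ.* 2 ℕ.^ (8 ℕ.* k)
  cross = cong₂ (λ x y → suc (4 ℕ.* k) ℕ.* x ℕ.* y) (ℕ.^-distribˡ-+-* B 2 2) (sym 2^[8k]≡P*P)

c⁻¹*c≡1 : ∀ n → c⁻¹ n * c n ≡ 1ℚ
c⁻¹*c≡1 n = begin
  c⁻¹ n * c n                              ≡⟨ cong (c⁻¹ n *_) (fromℕ-*-/ₙ (s ℕ.^ 2) (B ℕ.^ 2) P) ⟩
  (P /ₙ D) * ((s ℕ.^ 2 ℕ.* B ℕ.^ 2) /ₙ P)  ≡⟨ /ₙ-* P (s ℕ.^ 2 ℕ.* B ℕ.^ 2) D P ⟩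
  (P ℕ.* D) /ₙ (D ℕ.* P)                   ≡⟨ /ₙ-cross (P ℕ.* D) 1 (D ℕ.* P) 1 (cross P D) ⟩
  1ℚ                                       ∎
  where
  s = suc (2 ℕ.* n)
  B = (2 ℕ.* n) C n
  P = 2 ℕ.^ (4 ℕ.* n)
  D = s ℕ.^ 2 ℕ.* B ℕ.^ 2
  instance
    _ = m^n≢0 2 (4 ℕ.* n)
    _ = m*n≢0 (s ℕ.^ 2) (B ℕ.^ 2) {{m^n≢0 s 2}} {{m^n≢0 B 2 {{central-nonZero n}}}}
    _ = m*n≢0 D P
  cross : ∀ x y → x ℕ.* y ℕ.* 1 ≡ 1 ℕ.* (y ℕ.* x)
  cross = ℕ-Solver.solve-∀

σ : ℕ → ℕ → ℚ
σ n k = 1 /ₙ suc (2 ℕ.* n ∸ 2 ℕ.* k)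

ρ : ℕ → ℕ → ℚ
ρ n k = 1 /ₙ suc (n ℕ.+ k)

S₁ S₂ T : ℕ → ℚ
S₁ n = Σ-to n (λ k → a k * σ n k)
S₂ n = Σ-to n (λ k → a k * ρ n k)
T n = Σ-to n b

H₁ H₂ : ℕ → ℕ → ℚ
H₁ n k = a (suc n) * w k * σ (suc n) k
H₂ n k = a (suc n) * w k * ρ n k

x*w[0]*y≡0 : ∀ x y → x * w 0 * y ≡ 0ℚ
x*w[0]*y≡0 x y = trans (cong (_* y) (*-zeroʳ x)) (*-zeroˡ y)

σ[k+j]k≡1/[2j+1] : ∀ k j → σ (k ℕ.+ j) k ≡ 1 /ₙ suc (2 ℕ.* j)
σ[k+j]k≡1/[2j+1] k j = cong (λ m → 1 /ₙ suc m)
  (trans (cong (_∸ 2 ℕ.* k) (ℕ.*-distribˡ-+ 2 k j)) (ℕ.m+n∸m≡n (2 ℕ.* k) (2 ℕ.* j)))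

σ-diag : ∀ m → σ m m ≡ 1ℚ
σ-diag m = cong (λ d → 1 /ₙ suc d) (ℕ.n∸n≡0 (2 ℕ.* m))

S₁-step : ∀ {n} k j → k ℕ.+ j ≡ n →
          c n * (a k * σ n k) + H₁ n k ≡ c (suc n) * (a k * σ (suc n) k) + H₁ n (suc k)
S₁-step {n} k j refl = begin
  c n * (a k * σ n k) + H₁ n k
    ≡⟨ cong (λ t → t * (a k * σ n k) + H₁ n k) (c≡w[k+1] n) ⟩
  w (suc n) * (a k * σ n k) + H₁ n k
    ≡⟨ telescoping-step (a (suc n)) (a k) (σ (suc n) k) (σ n k)
         (fromℕ ((2 ℕ.* suc n) ℕ.^ 2)) (fromℕ (suc (2 ℕ.* suc n) ℕ.^ 2))
         (fromℕ (suc (2 ℕ.* k) ℕ.^ 2)) (fromℕ ((2 ℕ.* k) ℕ.^ 2)) (fromℕ P)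
         (subst (λ t → t * fromℕ ((2 ℕ.* suc n) ℕ.^ 2) ≡ t * fromℕ (suc (2 ℕ.* k) ℕ.^ 2) + fromℕ P)
                (sym (σ[k+j]k≡1/[2j+1] k j))
                (x≡z+p*d⇒x/d≡z/d+p (suc (2 ℕ.* k) ℕ.^ 2) P (suc (2 ℕ.* j)) (expand₁ k j)))
         (subst (λ t → t * fromℕ (suc (2 ℕ.* suc n) ℕ.^ 2) ≡ t * fromℕ ((2 ℕ.* k) ℕ.^ 2) + fromℕ P)
                (sym σ[n+1]k≡1/[2j+3])
                (x≡z+p*d⇒x/d≡z/d+p ((2 ℕ.* k) ℕ.^ 2) P (suc (2 ℕ.* suc j)) (expand₂ k j))) ⟩
  c (suc n) * (a k * σ (suc n) k) + a (suc n) * c k * σ n k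
    ≡⟨ cong₂ (λ t r → c (suc n) * (a k * σ (suc n) k) + a (suc n) * t * r)
             (c≡w[k+1] k) (trans (σ[k+j]k≡1/[2j+1] k j) (sym (σ[k+j]k≡1/[2j+1] (suc k) j))) ⟩
  c (suc n) * (a k * σ (suc n) k) + H₁ n (suc k) ∎
  where
  P = 2 ℕ.* (k ℕ.+ j) ℕ.+ 2 ℕ.* k ℕ.+ 3
  σ[n+1]k≡1/[2j+3] : σ (suc (k ℕ.+ j)) k ≡ 1 /ₙ suc (2 ℕ.* suc j)
  σ[n+1]k≡1/[2j+3] = trans (cong (λ m → σ m k) (sym (ℕ.+-suc k j))) (σ[k+j]k≡1/[2j+1] k (suc j))
  expand₁ : ∀ k j → (2 ℕ.* suc (k ℕ.+ j)) ℕ.^ 2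
                    ≡ suc (2 ℕ.* k) ℕ.^ 2 ℕ.+ (2 ℕ.* (k ℕ.+ j) ℕ.+ 2 ℕ.* k ℕ.+ 3) ℕ.* suc (2 ℕ.* j)
  expand₁ = solve 2 (λ k j → (con 2 :* (con 1 :+ (k :+ j))) :^ 2
                       := (con 1 :+ con 2 :* k) :^ 2
                          :+ (con 2 :* (k :+ j) :+ con 2 :* k :+ con 3) :* (con 1 :+ con 2 :* j)) refl
  expand₂ : ∀ k j → suc (2 ℕ.* suc (k ℕ.+ j)) ℕ.^ 2
                    ≡ (2 ℕ.* k) ℕ.^ 2 ℕ.+ (2 ℕ.* (k ℕ.+ j) ℕ.+ 2 ℕ.* k ℕ.+ 3) ℕ.* suc (2 ℕ.* suc j)
  expand₂ = solve 2 (λ k j → (con 1 :+ con 2 :* (con 1 :+ (k :+ j))) :^ 2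
                       := (con 2 :* k) :^ 2
                          :+ (con 2 :* (k :+ j) :+ con 2 :* k :+ con 3) :* (con 1 :+ con 2 :* (con 1 :+ j))) refl

S₁-boundary : ∀ n → c (suc n) * (a (suc n) * σ (suc n) (suc n)) ≡ b (suc n) + H₁ n (suc n)
S₁-boundary n = begin
  c (suc n) * (e * σ (suc n) (suc n))
    ≡⟨ cong (λ m → fromℕ m * e * (e * σ (suc n) (suc n))) (square n) ⟩
  fromℕ (suc (4 ℕ.* suc n) ℕ.+ (2 ℕ.* suc n) ℕ.^ 2) * e * (e * σ (suc n) (suc n))
    ≡⟨ cong (λ x → x * e * (e * σ (suc n) (suc n))) (fromℕ-+ (suc (4 ℕ.* suc n)) ((2 ℕ.* suc n) ℕ.^ 2)) ⟩
  (fromℕ (suc (4 ℕ.* suc n)) + fromℕ ((2 ℕ.* suc n) ℕ.^ 2)) * e * (e * σ (suc n) (suc n))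
    ≡⟨ regroup e (σ (suc n) (suc n)) (fromℕ (suc (4 ℕ.* suc n))) (fromℕ ((2 ℕ.* suc n) ℕ.^ 2)) ⟩
  fromℕ (suc (4 ℕ.* suc n)) * (e * e) * σ (suc n) (suc n) + H₁ n (suc n)
    ≡⟨ cong (λ t → fromℕ (suc (4 ℕ.* suc n)) * (e * e) * t + H₁ n (suc n)) (σ-diag (suc n)) ⟩
  fromℕ (suc (4 ℕ.* suc n)) * (e * e) * 1ℚ + H₁ n (suc n)
    ≡⟨ cong (_+ H₁ n (suc n)) (trans (*-identityʳ _) (sym (b≡[4k+1]*a² (suc n)))) ⟩
  b (suc n) + H₁ n (suc n) ∎
  where
  e = a (suc n)
  square : ∀ n → suc (2 ℕ.* suc n) ℕ.^ 2 ≡ suc (4 ℕ.* suc n) ℕ.+ (2 ℕ.* suc n) ℕ.^ 2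
  square = solve 1 (λ n → (con 1 :+ con 2 :* (con 1 :+ n)) :^ 2
                          := (con 1 :+ con 4 :* (con 1 :+ n)) :+ (con 2 :* (con 1 :+ n)) :^ 2) refl
  regroup : ∀ e t Q W → (Q + W) * e * (e * t) ≡ Q * (e * e) * t + e * (W * e) * t
  regroup = solve-∀ ℚ-ring

c*S₁≡T : ∀ n → c n * S₁ n ≡ T n
c*S₁≡T zero    = refl
c*S₁≡T (suc n) = begin
  c (suc n) * S₁ (suc n)
    ≡⟨ *-distribˡ-+ (c (suc n)) (Σ-to n (λ k → a k * σ (suc n) k)) (a (suc n) * σ (suc n) (suc n)) ⟩
  c (suc n) * Σ-to n (λ k → a k * σ (suc n) k) + c (suc n) * (a (suc n) * σ (suc n) (suc n))
    ≡⟨ cong (c (suc n) * Σ-to n (λ k → a k * σ (suc n) k) +_) (S₁-boundary n) ⟩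
  c (suc n) * Σ-to n (λ k → a k * σ (suc n) k) + (b (suc n) + H₁ n (suc n))
    ≡⟨ x∙yz≈xz∙y (c (suc n) * Σ-to n (λ k → a k * σ (suc n) k)) (b (suc n)) (H₁ n (suc n)) ⟩
  c (suc n) * Σ-to n (λ k → a k * σ (suc n) k) + H₁ n (suc n) + b (suc n)
    ≡⟨ cong (_+ b (suc n))
            (scaled-Σ-to-telescope n (c n) (c (suc n)) (λ k → a k * σ n k) (λ k → a k * σ (suc n) k) (H₁ n)
                                   (x*w[0]*y≡0 (a (suc n)) (σ (suc n) 0)) step) ⟨
  c n * S₁ n + b (suc n)
    ≡⟨ cong (_+ b (suc n)) (c*S₁≡T n) ⟩
  T n + b (suc n) ∎
  where
  step : ∀ k → k ≤ n → c n * (a k * σ n k) + H₁ n k ≡ c (suc n) * (a k * σ (suc n) k) + H₁ n (suc k)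
  step k k≤n = let j , k+j≡n = ℕ.m≤n⇒∃[o]m+o≡n k≤n in S₁-step k j k+j≡n

S₂-step : ∀ {n} k j → k ℕ.+ j ≡ n →
          c (suc n) * (a k * ρ (suc n) k) + H₂ n k ≡ c n * (a k * ρ n k) + H₂ n (suc k)
S₂-step {n} k j refl = begin
  c (suc n) * (a k * ρ (suc n) k) + H₂ n k
    ≡⟨ telescoping-step (a (suc n)) (a k) (ρ n k) (ρ (suc n) k)
         (fromℕ (suc (2 ℕ.* suc n) ℕ.^ 2)) (fromℕ ((2 ℕ.* suc n) ℕ.^ 2))
         (fromℕ (suc (2 ℕ.* k) ℕ.^ 2)) (fromℕ ((2 ℕ.* k) ℕ.^ 2)) (fromℕ (4 ℕ.* suc j))
         (x≡z+p*d⇒x/d≡z/d+p (suc (2 ℕ.* k) ℕ.^ 2) (4 ℕ.* suc j) (suc (suc n ℕ.+ k)) (expand₁ k j))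
         (x≡z+p*d⇒x/d≡z/d+p ((2 ℕ.* k) ℕ.^ 2) (4 ℕ.* suc j) (suc (n ℕ.+ k)) (expand₂ k j)) ⟩
  w (suc n) * (a k * ρ n k) + a (suc n) * c k * ρ (suc n) k
    ≡⟨ cong₂ _+_ (cong (_* (a k * ρ n k)) (sym (c≡w[k+1] n)))
                 (cong₂ (λ t r → a (suc n) * t * r) (c≡w[k+1] k)
                        (cong (λ m → 1 /ₙ suc m) (sym (ℕ.+-suc n k)))) ⟩
  c n * (a k * ρ n k) + H₂ n (suc k) ∎
  where
  expand₁ : ∀ k j → suc (2 ℕ.* suc (k ℕ.+ j)) ℕ.^ 2
                    ≡ suc (2 ℕ.* k) ℕ.^ 2 ℕ.+ 4 ℕ.* suc j ℕ.* suc (suc (k ℕ.+ j) ℕ.+ k)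
  expand₁ = solve 2 (λ k j → (con 1 :+ con 2 :* (con 1 :+ (k :+ j))) :^ 2
                       := (con 1 :+ con 2 :* k) :^ 2
                          :+ con 4 :* (con 1 :+ j) :* (con 1 :+ ((con 1 :+ (k :+ j)) :+ k))) refl
  expand₂ : ∀ k j → (2 ℕ.* suc (k ℕ.+ j)) ℕ.^ 2
                    ≡ (2 ℕ.* k) ℕ.^ 2 ℕ.+ 4 ℕ.* suc j ℕ.* suc (k ℕ.+ j ℕ.+ k)
  expand₂ = solve 2 (λ k j → (con 2 :* (con 1 :+ (k :+ j))) :^ 2
                       := (con 2 :* k) :^ 2 :+ con 4 :* (con 1 :+ j) :* (con 1 :+ (k :+ j :+ k))) refl

S₂-boundary : ∀ n → H₂ n (suc n) + c (suc n) * (a (suc n) * ρ (suc n) (suc n)) ≡ b (suc n)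
S₂-boundary n = begin
  H₂ n (suc n) + c (suc n) * (e * ρ (suc n) (suc n))
    ≡⟨ regroup e (ρ n (suc n)) (ρ (suc n) (suc n))
               (fromℕ ((2 ℕ.* suc n) ℕ.^ 2)) (fromℕ (suc (2 ℕ.* suc n) ℕ.^ 2)) ⟩
  (ρ n (suc n) * fromℕ ((2 ℕ.* suc n) ℕ.^ 2) + ρ (suc n) (suc n) * fromℕ (suc (2 ℕ.* suc n) ℕ.^ 2)) * (e * e)
    ≡⟨ cong₂ (λ p q → (p + q) * (e * e))
             (x≡p*d⇒x/d≡p (2 ℕ.* suc n) (suc (n ℕ.+ suc n)) (square₁ n))
             (x≡p*d⇒x/d≡p (suc (2 ℕ.* suc n)) (suc (suc n ℕ.+ suc n)) (square₂ n)) ⟩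
  (fromℕ (2 ℕ.* suc n) + fromℕ (suc (2 ℕ.* suc n))) * (e * e)
    ≡⟨ cong (_* (e * e)) (fromℕ-+ (2 ℕ.* suc n) (suc (2 ℕ.* suc n))) ⟨
  fromℕ (2 ℕ.* suc n ℕ.+ suc (2 ℕ.* suc n)) * (e * e)
    ≡⟨ cong (λ m → fromℕ m * (e * e)) (sum n) ⟩
  fromℕ (suc (4 ℕ.* suc n)) * (e * e)
    ≡⟨ b≡[4k+1]*a² (suc n) ⟨
  b (suc n) ∎
  where
  e = a (suc n)
  regroup : ∀ e u t W X → e * (W * e) * u + X * e * (e * t) ≡ (u * W + t * X) * (e * e)
  regroup = solve-∀ ℚ-ring
  square₁ : ∀ n → (2 ℕ.* suc n) ℕ.^ 2 ≡ 2 ℕ.* suc n ℕ.* suc (n ℕ.+ suc n)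
  square₁ = solve 1 (λ n → (con 2 :* (con 1 :+ n)) :^ 2 := con 2 :* (con 1 :+ n) :* (con 1 :+ (n :+ (con 1 :+ n)))) refl
  square₂ : ∀ n → suc (2 ℕ.* suc n) ℕ.^ 2 ≡ suc (2 ℕ.* suc n) ℕ.* suc (suc n ℕ.+ suc n)
  square₂ = solve 1 (λ n → (con 1 :+ con 2 :* (con 1 :+ n)) :^ 2
                          := (con 1 :+ con 2 :* (con 1 :+ n)) :* (con 1 :+ ((con 1 :+ n) :+ (con 1 :+ n)))) refl
  sum : ∀ n → 2 ℕ.* suc n ℕ.+ suc (2 ℕ.* suc n) ≡ suc (4 ℕ.* suc n)
  sum = ℕ-Solver.solve-∀

c*S₂≡T : ∀ n → c n * S₂ n ≡ T n
c*S₂≡T zero    = refl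
c*S₂≡T (suc n) = begin
  c (suc n) * S₂ (suc n)
    ≡⟨ *-distribˡ-+ (c (suc n)) (Σ-to n (λ k → a k * ρ (suc n) k)) (a (suc n) * ρ (suc n) (suc n)) ⟩
  c (suc n) * Σ-to n (λ k → a k * ρ (suc n) k) + c (suc n) * (a (suc n) * ρ (suc n) (suc n))
    ≡⟨ cong (_+ c (suc n) * (a (suc n) * ρ (suc n) (suc n)))
            (scaled-Σ-to-telescope n (c (suc n)) (c n) (λ k → a k * ρ (suc n) k) (λ k → a k * ρ n k) (H₂ n)
                                   (x*w[0]*y≡0 (a (suc n)) (ρ n 0)) step) ⟩
  c n * S₂ n + H₂ n (suc n) + c (suc n) * (a (suc n) * ρ (suc n) (suc n))
    ≡⟨ +-assoc (c n * S₂ n) (H₂ n (suc n)) (c (suc n) * (a (suc n) * ρ (suc n) (suc n))) ⟩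
  c n * S₂ n + (H₂ n (suc n) + c (suc n) * (a (suc n) * ρ (suc n) (suc n)))
    ≡⟨ cong₂ _+_ (c*S₂≡T n) (S₂-boundary n) ⟩
  T n + b (suc n) ∎
  where
  step : ∀ k → k ≤ n → c (suc n) * (a k * ρ (suc n) k) + H₂ n k ≡ c n * (a k * ρ n k) + H₂ n (suc k)
  step k k≤n = let j , k+j≡n = ℕ.m≤n⇒∃[o]m+o≡n k≤n in S₂-step k j k+j≡n

c*S≡T⇒S≡c⁻¹*T : ∀ n {S} → c n * S ≡ T n → S ≡ c⁻¹ n * T n
c*S≡T⇒S≡c⁻¹*T n {S} cS≡T = begin
  S                 ≡⟨ *-identityˡ S ⟨
  1ℚ * S            ≡⟨ cong (_* S) (c⁻¹*c≡1 n) ⟨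
  c⁻¹ n * c n * S   ≡⟨ *-assoc (c⁻¹ n) (c n) S ⟩
  c⁻¹ n * (c n * S) ≡⟨ cong (c⁻¹ n *_) cS≡T ⟩
  c⁻¹ n * T n       ∎

lemma2p3 : (n : ℕ) →
    (Σ-to n (λ k → (_/ₙ_ (((2 ℕ.* k) C k) ℕ.^ 2) (2 ℕ.^ (4 ℕ.* k)) {{m^n≢0 2 (4 ℕ.* k)}}) * (1 /ₙ suc (2 ℕ.* n ∸ 2 ℕ.* k)))
      ≡ Σ-to n (λ k → (_/ₙ_ (((2 ℕ.* k) C k) ℕ.^ 2) (2 ℕ.^ (4 ℕ.* k)) {{m^n≢0 2 (4 ℕ.* k)}}) * (1 /ₙ suc (n ℕ.+ k))))
    × (Σ-to n (λ k → (_/ₙ_ (((2 ℕ.* k) C k) ℕ.^ 2) (2 ℕ.^ (4 ℕ.* k)) {{m^n≢0 2 (4 ℕ.* k)}}) * (1 /ₙ suc (n ℕ.+ k)))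
      ≡ (_/ₙ_ (2 ℕ.^ (4 ℕ.* n)) ((suc (2 ℕ.* n) ℕ.^ 2) ℕ.* (((2 ℕ.* n) C n) ℕ.^ 2))
              {{m*n≢0 (suc (2 ℕ.* n) ℕ.^ 2) (((2 ℕ.* n) C n) ℕ.^ 2) {{m^n≢0 (suc (2 ℕ.* n)) 2}} {{m^n≢0 ((2 ℕ.* n) C n) 2 {{central-nonZero n}}}}}})
        * Σ-to n (λ k → _/ₙ_ (suc (4 ℕ.* k) ℕ.* ((2 ℕ.* k) C k) ℕ.^ 4) (2 ℕ.^ (8 ℕ.* k)) {{m^n≢0 2 (8 ℕ.* k)}}))
lemma2p3 n = trans S₁≡c⁻¹*T (sym S₂≡c⁻¹*T) , S₂≡c⁻¹*T
  where
  S₁≡c⁻¹*T : S₁ n ≡ c⁻¹ n * T n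
  S₁≡c⁻¹*T = c*S≡T⇒S≡c⁻¹*T n (c*S₁≡T n)
  S₂≡c⁻¹*T : S₂ n ≡ c⁻¹ n * T n
  S₂≡c⁻¹*T = c*S≡T⇒S≡c⁻¹*T n (c*S₂≡T n)
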